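{- Fix integers $\lambda \geq 2$ and $t \geq 1$. Let $H$ be a Hamiltonian finite simple graph with $m \geq \lambda$ vertices, and let $u_0$ be a vertex of $H$. If $d_H(u_0) \geq 2t-1 + \max\{2\lambda - m - 1, 2\}$, then there exists $l \geq \lambda$ such that $H$ contains a copy of $C_t(l)$ whose center is $u_0$.
   Context: $d_H(u)$ denotes the degree of $u$ in $H$. A keyring $C_t(l)$ is the $(l+t)$-edge graph obtained from a cycle of length $l$ by appending $t$ new leaves (pendant vertices) to one of the vertices of the cycle; that vertex (of degree $t+2$) is called the center. -}

module Defs where

open import Data.Nat using (ℕ; zero; suc; _+_; _≤_; _⊔_)
open import Data.Nat.Properties using ()
open import Data.Fin using (Fin; toℕ; fromℕ<)
open import Data.Fin.Properties using ()
open import Data.Bool using (Bool; true; false; T)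
open import Data.List using (List; length; filter; allFin)
open import Data.Product using (Σ; _×_; ∃; ∃-syntax; _,_)
open import Data.Nat.DivMod using (_%_; m%n<n)
open import Relation.Binary.PropositionalEquality using (_≡_; _≢_)
open import Relation.Nullary using (¬_)
open import Function.Definitions using (Injective)
open import Function.Bundles using (_↔_)
open import Data.Bool.Properties using (T?)

record Graph (n : ℕ) : Set where
  field
    adj   : Fin n → Fin n → Bool
    sym   : ∀ u v → adj u v ≡ adj v u
    irrefl : ∀ u → adj u u ≡ false

open Graph public

Adj : ∀ {n} → Graph n → Fin n → Fin n → Set
Adj G u v = T (adj G u v)

degree : ∀ {n} → Graph n → Fin n → ℕ
degree G u = length (filter (λ v → T? (adj G u v)) (allFin _))

next : ∀ {l} → Fin l → Fin l
next {suc l} i = fromℕ< (m%n<n (suc (toℕ i)) (suc l))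

record Cycle {n : ℕ} (G : Graph n) (l : ℕ) : Set where
  field
    len≥3  : 3 ≤ l
    vtx    : Fin l → Fin n
    inj    : Injective _≡_ _≡_ vtx
    edges  : ∀ i → Adj G (vtx i) (vtx (next i))

open Cycle public

Hamiltonian : ∀ {n} → Graph n → Set
Hamiltonian {n} G = Cycle G n

-- G contains a copy of the keyring C_t(l) (a cycle of length l with t
-- pendant leaves attached to one cycle vertex) whose center is u₀.
record Keyring {n : ℕ} (G : Graph n) (t l : ℕ) (u₀ : Fin n) : Set where
  field
    cyc       : Cycle G l
    centre    : Σ (Fin l) (λ i → vtx cyc i ≡ u₀)
    leaf      : Fin t → Fin n
    leaf-inj  : Injective _≡_ _≡_ leaf
    leaf-adj  : ∀ j → Adj G u₀ (leaf j)
    leaf-off  : ∀ j i → leaf j ≢ vtx cyc i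

-- Read the Hamiltonian cycle as u₀ = w 0, w 1, …, w (m − 1), and let a₀ < a₁ < ⋯ be the positions
-- of the neighbours of u₀; there are at least 2t + 1 + e of them, where 2λ′ ≤ m + 3 + e.  The arc
-- w 0 … w aₜ₊ₑ closes through the chord w aₜ₊ₑ u₀ to a cycle of length aₜ₊ₑ + 1 avoiding the t
-- neighbours aₜ₊ₑ₊₁, …, a₂ₜ₊ₑ, which become the leaves.  Traversing the cycle in the opposite
-- direction, the arc w aₜ … w m (= u₀) gives in the same way a keyring of length m − aₜ + 1 with
-- leaves a₀, …, aₜ₋₁.  As aₜ₊ₑ ≥ aₜ + e, the two lengths add up to at least m + e + 2 ≥ 2λ′ − 1,
-- so one of them is at least λ′.
module Submission where

open import Defs
open import Data.Nat
open import Data.Nat.Properties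
open import Data.Nat.DivMod
open import Data.Nat.Tactic.RingSolver using (solve-∀)
open import Data.Fin as Fin using (Fin; toℕ; fromℕ<)
open import Data.Fin.Properties using (toℕ-injective; toℕ-fromℕ<; toℕ<n; any?; punchOut-injective; injective⇒≤)
import Data.Fin.Properties as Finₚ
open import Data.Bool using (T)
open import Data.Bool.Properties using (T?)
open import Data.List using (List; _∷_; length; lookup; map; filter; upTo; allFin)
open import Data.List.Properties using (length-map)
import Data.List.Relation.Unary.All as All
import Data.List.Relation.Unary.Any as Any
open import Data.List.Relation.Unary.Any.Properties using (lookup-index)
open import Data.List.Relation.Unary.AllPairs as AllPairs using (AllPairs; _∷_)
import Data.List.Relation.Unary.AllPairs.Properties as AllPairs
open import Data.List.Relation.Unary.Unique.Propositional using (Unique)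
import Data.List.Relation.Unary.Unique.Propositional.Properties as Unique
open import Data.List.Membership.Propositional using (_∈_)
open import Data.List.Membership.Propositional.Properties
  using (∈-lookup; ∈-filter⁺; ∈-filter⁻; ∈-upTo⁺; ∈-upTo⁻; ∈-map⁺)
open import Data.List.Relation.Binary.Subset.Propositional using (_⊆_)
open import Data.Product using (Σ; ∃; _×_; _,_; proj₁; proj₂)
open import Data.Sum using (_⊎_; inj₁; inj₂)
open import Function using (id; _∘_)
open import Function.Definitions using (Injective)
open import Level using (Level)
open import Relation.Binary using (Rel; tri<; tri≈; tri>)
open import Relation.Binary.PropositionalEquality as ≡ using (_≡_; _≢_; refl; cong; cong₂; subst; subst₂; module ≡-Reasoning)
open import Relation.Nullary using (¬_; Dec; yes; no; contradiction)

private variable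
  a r : Level
  A : Set a

injective⇒surjective : ∀ {n} {f : Fin n → Fin n} → Injective _≡_ _≡_ f → ∀ y → ∃ λ x → f x ≡ y
injective⇒surjective {suc n} {f} f-inj y with any? (λ x → f x Fin.≟ y)
... | yes hit = hit
... | no miss = contradiction (injective⇒≤ punchOut-f-injective) (1+n≰n {n})
  where
  -- with y outside the image, punching y out of f injects Fin (suc n) into Fin n
  y≢f : ∀ x → y ≢ f x
  y≢f x eq = miss (x , ≡.sym eq)
  punchOut-f-injective : Injective _≡_ _≡_ (λ x → Fin.punchOut (y≢f x))
  punchOut-f-injective {x} {x′} eq = f-inj (punchOut-injective (y≢f x) (y≢f x′) eq)

AllPairs-lookup : ∀ {R : Rel A r} {xs} → AllPairs R xs →
                  ∀ {i j} → i Fin.< j → R (lookup xs i) (lookup xs j)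
AllPairs-lookup (x~xs ∷ _)  {Fin.zero}  {Fin.suc j} _         = All.lookup x~xs (∈-lookup j)
AllPairs-lookup (_ ∷ pairs) {Fin.suc i} {Fin.suc j} (s≤s i<j) = AllPairs-lookup pairs i<j

Unique⇒lookup-injective : ∀ {xs : List A} → Unique xs → Injective _≡_ _≡_ (lookup xs)
Unique⇒lookup-injective xs! {i} {j} eq with Finₚ.<-cmp i j
... | tri< i<j _ _ = contradiction eq (AllPairs-lookup xs! i<j)
... | tri≈ _ i≡j _ = i≡j
... | tri> _ _ j<i = contradiction (≡.sym eq) (AllPairs-lookup xs! j<i)

Unique⇒length-≤ : ∀ {xs ys : List A} → Unique xs → xs ⊆ ys → length xs ≤ length ys
Unique⇒length-≤ {xs = xs} {ys} xs! xs⊆ys = injective⇒≤ position-injective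
  where
  position : Fin (length xs) → Fin (length ys)
  position i = Any.index (xs⊆ys (∈-lookup i))

  position-injective : Injective _≡_ _≡_ position
  position-injective {i} {j} eq = Unique⇒lookup-injective xs! (begin
    lookup xs i            ≡⟨ lookup-index (xs⊆ys (∈-lookup i)) ⟩
    lookup ys (position i) ≡⟨ cong (lookup ys) eq ⟩
    lookup ys (position j) ≡⟨ lookup-index (xs⊆ys (∈-lookup j)) ⟨
    lookup xs j            ∎)
    where open ≡-Reasoning

lookup-gap : ∀ {xs : List ℕ} → AllPairs _<_ xs →
             ∀ {i j} → i Fin.≤ j → lookup xs i + (toℕ j ∸ toℕ i) ≤ lookup xs j
lookup-gap {x ∷ _}      _                  {Fin.zero}  {Fin.zero}  _         = ≤-reflexive (+-identityʳ x)
lookup-gap {x ∷ y ∷ ys} (x<ys ∷ y<ys∷pairs) {Fin.zero}  {Fin.suc j} _         = begin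
  x + suc (toℕ j)       ≡⟨ +-suc x (toℕ j) ⟩
  suc x + toℕ j         ≤⟨ +-monoˡ-≤ (toℕ j) (All.head x<ys) ⟩
  y + toℕ j             ≤⟨ lookup-gap y<ys∷pairs {Fin.zero} {j} z≤n ⟩
  lookup (y ∷ ys) j     ∎
  where open ≤-Reasoning
lookup-gap (_ ∷ pairs) {Fin.suc i} {Fin.suc j} (s≤s i≤j) = lookup-gap pairs i≤j

[m+n%d]%d≡[m+n]%d : ∀ m n d .{{_ : NonZero d}} → (m + n % d) % d ≡ (m + n) % d
[m+n%d]%d≡[m+n]%d m n d = begin
  (m + n % d) % d         ≡⟨ %-distribˡ-+ m (n % d) d ⟩
  (m % d + n % d % d) % d ≡⟨ cong (λ z → (m % d + z) % d) (m%n%n≡m%n n d) ⟩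
  (m % d + n % d) % d     ≡⟨ %-distribˡ-+ m n d ⟨
  (m + n) % d             ∎
  where open ≡-Reasoning

[x+[y+i]%n]%n≡i : ∀ x y {i n} .{{_ : NonZero n}} → x + y ≡ n → i < n → (x + (y + i) % n) % n ≡ i
[x+[y+i]%n]%n≡i x y {i} {n} x+y≡n i<n = begin
  (x + (y + i) % n) % n ≡⟨ [m+n%d]%d≡[m+n]%d x (y + i) n ⟩
  (x + (y + i)) % n     ≡⟨ cong (_% n) (+-assoc x y i) ⟨
  (x + y + i) % n       ≡⟨ cong (λ z → (z + i) % n) x+y≡n ⟩
  (n + i) % n           ≡⟨ cong (_% n) (+-comm n i) ⟩
  (i + n) % n           ≡⟨ [m+n]%n≡m%n i n ⟩
  i % n                 ≡⟨ m<n⇒m%n≡m i<n ⟩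
  i                     ∎
  where open ≡-Reasoning

[a+i]%n≡[a+j]%n⇒i≡j : ∀ a {i j n} .{{_ : NonZero n}} → i < n → j < n → (a + i) % n ≡ (a + j) % n → i ≡ j
[a+i]%n≡[a+j]%n⇒i≡j a {i} {j} {n} i<n j<n eq = begin
  i                         ≡⟨ unshift i<n ⟨
  (n ∸ a % n + (a + i) % n) % n ≡⟨ cong (λ z → (n ∸ a % n + z) % n) eq ⟩
  (n ∸ a % n + (a + j) % n) % n ≡⟨ unshift j<n ⟩
  j                         ∎
  where
  open ≡-Reasoning
  reduce-base : ∀ k → (a + k) % n ≡ (a % n + k) % n
  reduce-base k = begin
    (a + k) % n     ≡⟨ cong (_% n) (+-comm a k) ⟩
    (k + a) % n     ≡⟨ [m+n%d]%d≡[m+n]%d k a n ⟨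
    (k + a % n) % n ≡⟨ cong (_% n) (+-comm k (a % n)) ⟩
    (a % n + k) % n ∎
  unshift : ∀ {k} → k < n → (n ∸ a % n + (a + k) % n) % n ≡ k
  unshift {k} k<n = begin
    (n ∸ a % n + (a + k) % n) % n     ≡⟨ cong (λ z → (n ∸ a % n + z) % n) (reduce-base k) ⟩
    (n ∸ a % n + (a % n + k) % n) % n ≡⟨ [x+[y+i]%n]%n≡i (n ∸ a % n) (a % n) (m∸n+n≡m (m%n≤n a n)) k<n ⟩
    k                                 ∎

mod-cong : ∀ m m′ {n} .{{_ : NonZero n}} → m % n ≡ m′ % n → m mod n ≡ m′ mod n
mod-cong _ _ eq = toℕ-injective (≡.trans (toℕ-fromℕ< _) (≡.trans eq (≡.sym (toℕ-fromℕ< _))))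

2*m≤1+a+b⇒m≤a⊎m≤b : ∀ {m a b} → 2 * m ≤ suc (a + b) → m ≤ a ⊎ m ≤ b
2*m≤1+a+b⇒m≤a⊎m≤b {m} {a} {b} 2m≤ with m ≤? a
... | yes m≤a = inj₁ m≤a
... | no  m≰a = inj₂ (+-cancelˡ-≤ m m b (begin
  m + m       ≡⟨ cong (m +_) (+-identityʳ m) ⟨
  2 * m       ≤⟨ 2m≤ ⟩
  suc a + b   ≤⟨ +-monoˡ-≤ b (≰⇒> m≰a) ⟩
  m + b       ∎))
  where open ≤-Reasoning

degree-threshold : ∀ t d → (2 * suc t ∸ 1) + (d ⊔ 2) ≡ suc (suc t + (d ⊔ 2 ∸ 2) + suc t)
degree-threshold t d = begin
  (2 * suc t ∸ 1) + (d ⊔ 2)           ≡⟨ cong ((2 * suc t ∸ 1) +_) (m+[n∸m]≡n (m≤n⊔m d 2)) ⟨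
  (2 * suc t ∸ 1) + (2 + (d ⊔ 2 ∸ 2)) ≡⟨ rearrange t (d ⊔ 2 ∸ 2) ⟩
  suc (suc t + (d ⊔ 2 ∸ 2) + suc t)   ∎
  where
  open ≡-Reasoning
  -- 2 * suc t ∸ 1 reduces to t + (suc t + 0).
  rearrange : ∀ t e → t + (suc t + 0) + (2 + e) ≡ suc (suc t + e + suc t)
  rearrange = solve-∀

length-threshold : ∀ λ′ n → 2 * λ′ ≤ n + 3 + ((2 * λ′ ∸ (n + 1)) ⊔ 2 ∸ 2)
length-threshold λ′ n = begin
  2 * λ′                         ≤⟨ m≤n+m∸n (2 * λ′) (n + 1) ⟩
  n + 1 + (2 * λ′ ∸ (n + 1))     ≤⟨ +-monoʳ-≤ (n + 1) (m≤m⊔n _ 2) ⟩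
  n + 1 + d                      ≡⟨ cong (n + 1 +_) (m+[n∸m]≡n (m≤n⊔m _ 2)) ⟨
  n + 1 + (2 + (d ∸ 2))          ≡⟨ rearrange n (d ∸ 2) ⟩
  n + 3 + (d ∸ 2)                ∎
  where
  open ≤-Reasoning
  d : ℕ
  d = (2 * λ′ ∸ (n + 1)) ⊔ 2
  rearrange : ∀ n e → n + 1 + (2 + e) ≡ n + 3 + e
  rearrange = solve-∀

module _ {n} (G : Graph n) where

  Adj-sym : ∀ {u v} → Adj G u v → Adj G v u
  Adj-sym {u} {v} = subst T (sym G u v)

  Adj-irrefl : ∀ {u} → ¬ Adj G u u
  Adj-irrefl {u} = subst T (irrefl G u)

toℕ-next : ∀ {l} (i : Fin (suc l)) → toℕ (next i) ≡ suc (toℕ i) % suc l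
toℕ-next i = toℕ-fromℕ< _

record PathFrom {n} (G : Graph n) (u : Fin n) (M : ℕ) : Set where
  field
    walk           : ℕ → Fin n
    start          : walk 0 ≡ u
    step           : ∀ {p} → suc p < M → Adj G (walk p) (walk (suc p))
    walk-injective : ∀ {p q} → p < M → q < M → walk p ≡ walk q → p ≡ q

module _ {n M} {G : Graph n} {u : Fin n} (P : PathFrom G u M) where
  open PathFrom P

  closePath : ∀ {x} → 2 ≤ x → x < M → Adj G u (walk x) → Cycle G (suc x)
  closePath {x} 2≤x x<M u~x = record
    { len≥3 = s≤s 2≤x
    ; vtx   = walk ∘ toℕ
    ; inj   = λ eq → toℕ-injective (walk-injective (on-path _) (on-path _) eq)
    ; edges = edge }
    where
    on-path : (i : Fin (suc x)) → toℕ i < M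
    on-path i = ≤-<-trans (≤-pred (toℕ<n i)) x<M

    edge : ∀ i → Adj G (walk (toℕ i)) (walk (toℕ (next i)))
    edge i with m≤n⇒m<n∨m≡n (≤-pred (toℕ<n i))
    ... | inj₁ i<x = subst (λ p → Adj G (walk (toℕ i)) (walk p))
                       (≡.sym (≡.trans (toℕ-next i) (m<n⇒m%n≡m (s≤s i<x))))
                       (step (<-≤-trans (s≤s i<x) x<M))
    ... | inj₂ i≡x = subst₂ (λ p q → Adj G (walk p) (walk q)) (≡.sym i≡x)
                       (≡.sym (≡.trans (toℕ-next i) (≡.trans (cong (λ z → suc z % suc x) i≡x) (n%n≡0 (suc x)))))
                       (Adj-sym G (subst (λ v → Adj G v (walk x)) (≡.sym start) u~x))

  keyringFromPath : ∀ {t x} → 2 ≤ x → x < M → Adj G u (walk x) →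
                    (leaf : Fin t → ℕ) → Injective _≡_ _≡_ leaf →
                    (∀ j → x < leaf j) → (∀ j → leaf j < M) → (∀ j → Adj G u (walk (leaf j))) →
                    Keyring G t (suc x) u
  keyringFromPath {x = x} 2≤x x<M u~x leaf leaf-injective x<leaf leaf<M u~leaf = record
    { cyc      = closePath 2≤x x<M u~x
    ; centre   = Fin.zero , start
    ; leaf     = walk ∘ leaf
    ; leaf-inj = λ eq → leaf-injective (walk-injective (leaf<M _) (leaf<M _) eq)
    ; leaf-adj = u~leaf
    ; leaf-off = off-cycle }
    where
    off-cycle : ∀ j i → walk (leaf j) ≢ walk (toℕ i)
    off-cycle j i eq = <⇒≱ (x<leaf j) (≤-trans (≤-reflexive leaf≡i) (≤-pred (toℕ<n i)))
      where
      leaf≡i : leaf j ≡ toℕ i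
      leaf≡i = walk-injective (leaf<M j) (≤-<-trans (≤-pred (toℕ<n i)) x<M) eq

module Around {n l} {G : Graph n} (c : Cycle G (suc l)) {u} (k : Fin (suc l)) (k↦u : vtx c k ≡ u) where

  around : ℕ → Fin n
  around p = vtx c ((toℕ k + p) mod suc l)

  around-step : ∀ p → Adj G (around p) (around (suc p))
  around-step p = subst (λ i′ → Adj G (around p) (vtx c i′)) (mod-cong (suc (toℕ i)) (toℕ k + suc p) next≡)
                    (edges c i)
    where
    open ≡-Reasoning
    i : Fin (suc l)
    i = (toℕ k + p) mod suc l
    next≡ : suc (toℕ i) % suc l ≡ (toℕ k + suc p) % suc l
    next≡ = begin
      suc (toℕ i) % suc l               ≡⟨ cong (λ z → suc z % suc l) (toℕ-fromℕ< _) ⟩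
      (1 + (toℕ k + p) % suc l) % suc l ≡⟨ [m+n%d]%d≡[m+n]%d 1 (toℕ k + p) (suc l) ⟩
      suc (toℕ k + p) % suc l           ≡⟨ cong (_% suc l) (+-suc (toℕ k) p) ⟨
      (toℕ k + suc p) % suc l           ∎

  around-injective : ∀ a {i j} → i < suc l → j < suc l → around (a + i) ≡ around (a + j) → i ≡ j
  around-injective a {i} {j} i<l j<l eq = [a+i]%n≡[a+j]%n⇒i≡j (toℕ k + a) i<l j<l (begin
    (toℕ k + a + i) % suc l   ≡⟨ cong (_% suc l) (+-assoc (toℕ k) a i) ⟩
    (toℕ k + (a + i)) % suc l ≡⟨ toℕ-fromℕ< _ ⟨
    toℕ ((toℕ k + (a + i)) mod suc l) ≡⟨ cong toℕ (inj c eq) ⟩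
    toℕ ((toℕ k + (a + j)) mod suc l) ≡⟨ toℕ-fromℕ< _ ⟩
    (toℕ k + (a + j)) % suc l ≡⟨ cong (_% suc l) (+-assoc (toℕ k) a j) ⟨
    (toℕ k + a + j) % suc l   ∎)
    where open ≡-Reasoning

  around-start : around 0 ≡ u
  around-start = ≡.trans (cong (vtx c) (toℕ-injective (begin
    toℕ ((toℕ k + 0) mod suc l) ≡⟨ toℕ-fromℕ< _ ⟩
    (toℕ k + 0) % suc l         ≡⟨ cong (_% suc l) (+-identityʳ (toℕ k)) ⟩
    toℕ k % suc l               ≡⟨ m<n⇒m%n≡m (toℕ<n k) ⟩
    toℕ k                       ∎))) k↦u
    where open ≡-Reasoning

  around-period : around (suc l) ≡ u
  around-period = ≡.trans (cong (vtx c) (mod-cong (toℕ k + suc l) (toℕ k + 0) period)) around-start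
    where
    period : (toℕ k + suc l) % suc l ≡ (toℕ k + 0) % suc l
    period = ≡.trans ([m+n]%n≡m%n (toℕ k) (suc l)) (cong (_% suc l) (≡.sym (+-identityʳ (toℕ k))))

  around-hits : ∀ i → ∃ λ p → p < suc l × around p ≡ vtx c i
  around-hits i = p , m%n<n (suc l ∸ toℕ k + toℕ i) (suc l) , cong (vtx c) (toℕ-injective (begin
    toℕ ((toℕ k + p) mod suc l) ≡⟨ toℕ-fromℕ< _ ⟩
    (toℕ k + p) % suc l         ≡⟨ [x+[y+i]%n]%n≡i (toℕ k) (suc l ∸ toℕ k) (m+[n∸m]≡n (<⇒≤ (toℕ<n k))) (toℕ<n i) ⟩
    toℕ i                       ∎))
    where
    open ≡-Reasoning
    p : ℕ
    p = (suc l ∸ toℕ k + toℕ i) % suc l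

  forward : PathFrom G u (suc l)
  forward = record
    { walk           = around
    ; start          = around-start
    ; step           = λ _ → around-step _
    ; walk-injective = around-injective 0 }

  backward : PathFrom G u (suc l)
  backward = record
    { walk           = λ p → around (suc l ∸ p)
    ; start          = around-period
    ; step           = step
    ; walk-injective = walk-injective }
    where
    unfold : ∀ {p} → p ≤ l → suc l ∸ p ≡ suc (l ∸ p)
    unfold = +-∸-assoc 1

    step : ∀ {p} → suc p < suc l → Adj G (around (suc l ∸ p)) (around (l ∸ p))
    step {p} (s≤s p<l) = subst (λ q → Adj G (around q) (around (l ∸ p))) (≡.sym (unfold (<⇒≤ p<l)))
                           (Adj-sym G (around-step (l ∸ p)))

    walk-injective : ∀ {p q} → p < suc l → q < suc l → around (suc l ∸ p) ≡ around (suc l ∸ q) → p ≡ q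
    walk-injective {p} {q} (s≤s p≤l) (s≤s q≤l) eq =
      ∸-cancelˡ-≡ p≤l q≤l (around-injective 1 (s≤s (m∸n≤m l p)) (s≤s (m∸n≤m l q))
        (subst₂ (λ p′ q′ → around p′ ≡ around q′) (unfold p≤l) (unfold q≤l) eq))

module NeighbourPositions {m} (H : Graph (suc m)) (ham : Hamiltonian H) (u₀ : Fin (suc m)) where

  private
    M : ℕ
    M = suc m

    centre-on-cycle : ∃ λ k → vtx ham k ≡ u₀
    centre-on-cycle = injective⇒surjective (inj ham) u₀

  open Around ham (proj₁ centre-on-cycle) (proj₂ centre-on-cycle)

  neighbour? : ∀ v → Dec (Adj H u₀ v)
  neighbour? v = T? (adj H u₀ v)

  adjacent? : ∀ p → Dec (Adj H u₀ (around p))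
  adjacent? p = T? (adj H u₀ (around p))

  positions : List ℕ
  positions = filter adjacent? (upTo M)

  positions-sorted : AllPairs _<_ positions
  positions-sorted = AllPairs.filter⁺ adjacent? (AllPairs.applyUpTo⁺₁ id M (λ i<j _ → i<j))

  ∈-positions⁻ : ∀ {p} → p ∈ positions → p < M × Adj H u₀ (around p)
  ∈-positions⁻ p∈ with p∈upTo , u₀~p ← ∈-filter⁻ adjacent? p∈ = ∈-upTo⁻ p∈upTo , u₀~p

  ∈-positions⇒0<p : ∀ {p} → p ∈ positions → 0 < p
  ∈-positions⇒0<p {zero}  p∈ =
    contradiction (subst (Adj H u₀) around-start (proj₂ (∈-positions⁻ p∈))) (Adj-irrefl H)
  ∈-positions⇒0<p {suc p} _  = z<s

  degree≤length-positions : degree H u₀ ≤ length positions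
  degree≤length-positions = begin
    degree H u₀                   ≤⟨ Unique⇒length-≤ (Unique.filter⁺ neighbour? (Unique.allFin⁺ M)) neighbours⊆ ⟩
    length (map around positions) ≡⟨ length-map around positions ⟩
    length positions              ∎
    where
    open ≤-Reasoning
    neighbours⊆ : filter neighbour? (allFin M) ⊆ map around positions
    neighbours⊆ {v} v∈
      with i , i↦v ← injective⇒surjective (inj ham) v
      with p , p<M , p↦i ← around-hits i
      with refl ← ≡.trans p↦i i↦v
      = ∈-map⁺ around (∈-filter⁺ adjacent? (∈-upTo⁺ p<M) (proj₂ (∈-filter⁻ neighbour? v∈)))

  positions-unique : Unique positions
  positions-unique = AllPairs.map <⇒≢ positions-sorted

  nth : (p : ℕ) → .(p < length positions) → ℕ
  nth p h = lookup positions (fromℕ< h)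

  module _ {p q} .{hp : p < length positions} .{hq : q < length positions} where

    nth-< : p < q → nth p hp < nth q hq
    nth-< p<q = AllPairs-lookup positions-sorted
                  (subst₂ _<_ (≡.sym (toℕ-fromℕ< hp)) (≡.sym (toℕ-fromℕ< hq)) p<q)

    nth-gap : p ≤ q → nth p hp + (q ∸ p) ≤ nth q hq
    nth-gap p≤q = subst (λ d → nth p hp + d ≤ nth q hq) (cong₂ _∸_ (toℕ-fromℕ< hq) (toℕ-fromℕ< hp))
                    (lookup-gap positions-sorted (subst₂ _≤_ (≡.sym (toℕ-fromℕ< hp)) (≡.sym (toℕ-fromℕ< hq)) p≤q))

    nth-injective : nth p hp ≡ nth q hq → p ≡ q
    nth-injective eq = ≡.trans (≡.sym (toℕ-fromℕ< hp))
                         (≡.trans (cong toℕ (Unique⇒lookup-injective positions-unique eq)) (toℕ-fromℕ< hq))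

  module _ {p} .{h : p < length positions} where

    0<nth : 0 < nth p h
    0<nth = ∈-positions⇒0<p (∈-lookup _)

    nth<M : nth p h < M
    nth<M = proj₁ (∈-positions⁻ (∈-lookup _))

    u₀~nth : Adj H u₀ (around (nth p h))
    u₀~nth = proj₂ (∈-positions⁻ (∈-lookup _))

  module Keyrings (t e : ℕ) (1≤t : 1 ≤ t) (enough : t + e + t < length positions) where

    t+e<length : t + e < length positions
    t+e<length = ≤-<-trans (m≤m+n (t + e) t) enough

    t<length : t < length positions
    t<length = ≤-<-trans (m≤m+n t e) t+e<length

    aₜ aₜ₊ₑ : ℕ
    aₜ   = nth t t<length
    aₜ₊ₑ = nth (t + e) t+e<length

    aₜ≤M : aₜ ≤ M
    aₜ≤M = <⇒≤ nth<M

    aₜ+e≤aₜ₊ₑ : aₜ + e ≤ aₜ₊ₑ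
    aₜ+e≤aₜ₊ₑ = subst (λ d → aₜ + d ≤ aₜ₊ₑ) (m+n∸m≡n t e) (nth-gap (m≤m+n t e))

    forward-keyring : Keyring H t (suc aₜ₊ₑ) u₀
    forward-keyring = keyringFromPath forward 2≤aₜ₊ₑ nth<M u₀~nth leaf leaf-injective
                        (λ j → nth-< (m≤m+n (suc (t + e)) (toℕ j))) (λ _ → nth<M) (λ _ → u₀~nth)
      where
      2≤aₜ₊ₑ : 2 ≤ aₜ₊ₑ
      2≤aₜ₊ₑ = ≤-trans (s≤s (0<nth {0} {≤-<-trans z≤n t+e<length})) (nth-< (≤-trans 1≤t (m≤m+n t e)))

      leaf-bound : (j : Fin t) → suc (t + e) + toℕ j < length positions
      leaf-bound j = ≤-<-trans (≤-reflexive (≡.sym (+-suc (t + e) (toℕ j))))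
                       (≤-<-trans (+-monoʳ-≤ (t + e) (toℕ<n j)) enough)

      leaf : Fin t → ℕ
      leaf j = nth (suc (t + e) + toℕ j) (leaf-bound j)

      leaf-injective : Injective _≡_ _≡_ leaf
      leaf-injective eq = toℕ-injective (+-cancelˡ-≡ (suc (t + e)) _ _ (nth-injective eq))

    backward-keyring : Keyring H t (suc (M ∸ aₜ)) u₀
    backward-keyring = keyringFromPath backward 2≤M∸aₜ (∸-monoʳ-< 0<nth aₜ≤M) (adjacent-back aₜ≤M u₀~nth)
                         leaf leaf-injective (λ j → ∸-monoʳ-< (nth-< (toℕ<n j)) aₜ≤M)
                         (λ _ → ∸-monoʳ-< 0<nth (<⇒≤ nth<M)) (λ _ → adjacent-back (<⇒≤ nth<M) u₀~nth)
      where
      adjacent-back : ∀ {p} → p ≤ M → Adj H u₀ (around p) → Adj H u₀ (around (M ∸ (M ∸ p)))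
      adjacent-back p≤M = subst (λ q → Adj H u₀ (around q)) (≡.sym (m∸[m∸n]≡n p≤M))

      2≤M∸aₜ : 2 ≤ M ∸ aₜ
      2≤M∸aₜ = m+n≤o⇒m≤o∸n 2 (≤-trans (s≤s (nth-< {hq = enough} t<t+e+t)) nth<M)
        where
        t<t+e+t : t < t + e + t
        t<t+e+t = ≤-<-trans (m≤m+n t e) (m<m+n (t + e) 1≤t)

      leaf-bound : (j : Fin t) → toℕ j < length positions
      leaf-bound j = <-trans (toℕ<n j) t<length

      leaf : Fin t → ℕ
      leaf j = M ∸ nth (toℕ j) (leaf-bound j)

      leaf-injective : Injective _≡_ _≡_ leaf
      leaf-injective eq = toℕ-injective (nth-injective (∸-cancelˡ-≡ (<⇒≤ nth<M) (<⇒≤ nth<M) eq))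

    cycles-long : M + 3 + e ≤ suc (suc aₜ₊ₑ + suc (M ∸ aₜ))
    cycles-long = begin
      M + 3 + e                         ≡⟨ cong (λ z → z + 3 + e) (m+[n∸m]≡n aₜ≤M) ⟨
      aₜ + (M ∸ aₜ) + 3 + e             ≡⟨ rearrange aₜ (M ∸ aₜ) e ⟩
      suc (suc (aₜ + e) + suc (M ∸ aₜ)) ≤⟨ s≤s (+-monoˡ-≤ (suc (M ∸ aₜ)) (s≤s aₜ+e≤aₜ₊ₑ)) ⟩
      suc (suc aₜ₊ₑ + suc (M ∸ aₜ))     ∎
      where
      open ≤-Reasoning
      rearrange : ∀ a d e → a + d + 3 + e ≡ suc (suc (a + e) + suc d)
      rearrange = solve-∀

    keyring : ∀ λ′ → 2 * λ′ ≤ M + 3 + e → Σ ℕ (λ l → λ′ ≤ l × Keyring H t l u₀)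
    keyring λ′ 2λ′≤ with 2*m≤1+a+b⇒m≤a⊎m≤b (≤-trans 2λ′≤ cycles-long)
    ... | inj₁ λ′≤ = suc aₜ₊ₑ , λ′≤ , forward-keyring
    ... | inj₂ λ′≤ = suc (M ∸ aₜ) , λ′≤ , backward-keyring

lemma1 : (λ′ t m : ℕ) → 2 ≤ λ′ → 1 ≤ t → λ′ ≤ m →
         (H : Graph m) → Hamiltonian H → (u₀ : Fin m) →
         (2 * t ∸ 1) + (((2 * λ′) ∸ (m + 1)) ⊔ 2) ≤ degree H u₀ →
         Σ ℕ (λ l → λ′ ≤ l × Keyring H t l u₀)
lemma1 λ′ (suc t) (suc m) _ 1≤t _ H ham u₀ deg = keyring λ′ (length-threshold λ′ (suc m))
  where
  open NeighbourPositions H ham u₀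
  e : ℕ
  e = ((2 * λ′ ∸ (suc m + 1)) ⊔ 2) ∸ 2
  enough : suc t + e + suc t < length positions
  enough = ≤-trans (≤-reflexive (≡.sym (degree-threshold t _))) (≤-trans deg degree≤length-positions)
  open Keyrings (suc t) e 1≤t enough
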